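{- Let $H$ be a hypergraph, $(Red,X,Blue)$ a partition of $V(H)$ such that no edge of $H$ contains both a vertex of $Red$ and a vertex of $Blue$, and $F$ a reduced elimination forest of $H$. Let $U\subseteq Red\cup Blue$. If $U=V(F_u)$ for some $u\in V(H)$, then $U$ is monochromatic. Furthermore, if $U=V(F_v)\cup\{u\}$ for some $u\in V(H)$ and a child $v$ of $u$, then $U$ is monochromatic.
   Context: A hypergraph $H$ has finite vertex set $V(H)$ and edges that are non-empty subsets of $V(H)$; two vertices are adjacent if some edge contains both. An elimination forest $F$ of $H$ is a rooted forest on $V(H)$ such that any two vertices of a common edge are in ancestor–descendant relation; $F_u$ denotes the subtree of descendants of $u$ (including $u$). $F$ is reduced if for each non-leaf vertex $u$ and each child $v$ of $u$, $u$ is adjacent in $H$ to some vertex of $V(F_v)$. A set $U\subseteq Red\cup Blue$ is monochromatic if $U\subseteq Red$ or $U\subseteq Blue$. -}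

module Defs where

open import Data.Nat using (ℕ)
open import Data.Fin using (Fin)
open import Data.Fin.Subset using (Subset; _∈_; Nonempty)
open import Data.List using (List)
open import Data.List.Relation.Unary.All using (All)
open import Data.List.Relation.Unary.Any using (Any)
open import Data.Maybe using (Maybe; just; nothing)
open import Data.Product using (Σ; ∃; _×_)
open import Data.Sum using (_⊎_)
open import Relation.Binary.PropositionalEquality using (_≡_; _≢_)

record Hypergraph (n : ℕ) : Set where
  field
    edges    : List (Subset n)
    nonempty : All Nonempty edges
open Hypergraph public

InCommonEdge : ∀ {n} → Hypergraph n → Fin n → Fin n → Set
InCommonEdge H x y = Any (λ e → (x ∈ e) × (y ∈ e)) (edges H)

Adjacent : ∀ {n} → Hypergraph n → Fin n → Fin n → Set
Adjacent H x y = (x ≢ y) × InCommonEdge H x y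

-- A rooted forest on Fin n is given by a parent map (nothing = root)
-- such that every vertex reaches a root by following parents.
ParentMap : ℕ → Set
ParentMap n = Fin n → Maybe (Fin n)

data ReachesRoot {n} (p : ParentMap n) : Fin n → Set where
  root : ∀ {v} → p v ≡ nothing → ReachesRoot p v
  step : ∀ {v w} → p v ≡ just w → ReachesRoot p w → ReachesRoot p v

IsForest : ∀ {n} → ParentMap n → Set
IsForest p = ∀ v → ReachesRoot p v

-- Anc p u v : u is an ancestor of v (reflexive), i.e. v ∈ V(F_u)
data Anc {n} (p : ParentMap n) (u : Fin n) : Fin n → Set where
  anc-refl : Anc p u u
  anc-step : ∀ {v w} → p v ≡ just w → Anc p u w → Anc p u v

IsEliminationForest : ∀ {n} → Hypergraph n → ParentMap n → Set
IsEliminationForest H p =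
  IsForest p × (∀ x y → InCommonEdge H x y → Anc p x y ⊎ Anc p y x)

IsReduced : ∀ {n} → Hypergraph n → ParentMap n → Set
IsReduced H p = ∀ u v → p v ≡ just u → ∃ λ w → Anc p v w × Adjacent H u w

-- partition (Red, X, Blue) of V(H) encoded as a colouring
data Colour : Set where
  red x blue : Colour

NoRedBlueEdge : ∀ {n} → Hypergraph n → (Fin n → Colour) → Set
NoRedBlueEdge H c = ∀ a b → InCommonEdge H a b → c a ≡ red → c b ≢ blue

InRedBlue : ∀ {n} → (Fin n → Colour) → (Fin n → Set) → Set
InRedBlue c U = ∀ w → U w → c w ≢ x

Monochromatic : ∀ {n} → (Fin n → Colour) → (Fin n → Set) → Set
Monochromatic c U = (∀ w → U w → c w ≡ red) ⊎ (∀ w → U w → c w ≡ blue)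

Subtree : ∀ {n} → ParentMap n → Fin n → Fin n → Set
Subtree p u w = Anc p u w

SubtreePlus : ∀ {n} → ParentMap n → Fin n → Fin n → Fin n → Set
SubtreePlus p v u w = Anc p v w ⊎ w ≡ u

-- A child v of u has the colour of u: by reducedness u shares an edge with some w ∈ V(F_v),
-- and an edge avoiding X cannot join Red to Blue, so c u = c w. Hence if c is constant on F_v
-- it extends to F_v ∪ {u}, and well-founded induction on the descendant order of the finite
-- forest makes c constant on every subtree contained in Red ∪ Blue.
module Submission where

open import Defs
open import Data.Nat using (ℕ)
open import Data.Fin using (Fin)
open import Data.Fin.Induction using (spo-wellFounded)
open import Data.Maybe using (just)
open import Data.Product using (_×_; _,_; ∃; proj₁; swap)
open import Data.Sum using (_⊎_; inj₁; inj₂)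
open import Data.Empty using (⊥-elim)
open import Data.List.Relation.Unary.Any as Any using ()
open import Relation.Nullary using (¬_)
open import Relation.Binary.Structures using (IsStrictPartialOrder)
open import Relation.Binary.PropositionalEquality
  using (_≡_; _≢_; refl; sym; trans; resp₂; isEquivalence)
open import Induction.WellFounded using (WellFounded; Acc; acc)

module _ {n : ℕ} (p : ParentMap n) where

  Below : Fin n → Fin n → Set
  Below v w = ∃ λ u → p v ≡ just u × Anc p w u

  anc-trans : ∀ {u v w} → Anc p u v → Anc p v w → Anc p u w
  anc-trans uv anc-refl        = uv
  anc-trans uv (anc-step e vw) = anc-step e (anc-trans uv vw)

  below⇒anc : ∀ {v w} → Below v w → Anc p w v
  below⇒anc (u , e , wu) = anc-step e wu

  below-trans : ∀ {u v w} → Below u v → Below v w → Below u w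
  below-trans (u′ , e , vu′) vw = u′ , e , anc-trans (below⇒anc vw) vu′

  below-irrefl : ∀ {v} → ReachesRoot p v → ¬ Below v v
  below-irrefl (root e)   (_ , e′ , _) with () ← trans (sym e) e′
  below-irrefl {v} (step {w = w} e r) (_ , e′ , vw) with refl ← trans (sym e) e′ =
    below-irrefl r (rotate vw)
    where
    rotate : Anc p v w → Below w w
    rotate anc-refl          = _ , e , anc-refl
    rotate (anc-step e″ vu)  = _ , e″ , anc-trans (anc-step e anc-refl) vu

  below-isStrictPartialOrder : IsForest p → IsStrictPartialOrder _≡_ Below
  below-isStrictPartialOrder forest = record
    { isEquivalence = isEquivalence
    ; irrefl        = λ { {v} refl → below-irrefl (forest v) }
    ; trans         = below-trans
    ; <-resp-≈      = resp₂ Below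
    }

  below-wellFounded : IsForest p → WellFounded Below
  below-wellFounded forest = spo-wellFounded (below-isStrictPartialOrder forest)

  anc-refl⊎viaChild : ∀ {w z} → Anc p w z → z ≡ w ⊎ ∃ λ v → p v ≡ just w × Anc p v z
  anc-refl⊎viaChild anc-refl = inj₁ refl
  anc-refl⊎viaChild (anc-step e wz) with anc-refl⊎viaChild wz
  ... | inj₁ refl            = inj₂ (_ , e , anc-refl)
  ... | inj₂ (v , e′ , vz′)  = inj₂ (v , e′ , anc-step e vz′)

colour-≡-on-edge : ∀ {n} (H : Hypergraph n) (c : Fin n → Colour) → NoRedBlueEdge H c
  → ∀ {a b} → InCommonEdge H a b → c a ≢ x → c b ≢ x → c a ≡ c b
colour-≡-on-edge H c noRedBlue {a} {b} ab a≢x b≢x with c a in ca | c b in cb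
... | red  | red  = refl
... | blue | blue = refl
... | x    | _    = ⊥-elim (a≢x refl)
... | _    | x    = ⊥-elim (b≢x refl)
... | red  | blue = ⊥-elim (noRedBlue a b ab ca cb)
... | blue | red  = ⊥-elim (noRedBlue b a (Any.map swap ab) cb ca)

monochromatic-if-constant : ∀ {n} (c : Fin n → Colour) (U : Fin n → Set) {w}
  → InRedBlue c U → U w → (∀ z → U z → c z ≡ c w) → Monochromatic c U
monochromatic-if-constant c U {w} redBlue Uw const with c w in cw
... | red  = inj₁ const
... | blue = inj₂ const
... | x    = ⊥-elim (redBlue w Uw cw)

module _ {n} (H : Hypergraph n) (c : Fin n → Colour) (p : ParentMap n)
  (noRedBlue : NoRedBlueEdge H c) (reduced : IsReduced H p) where

  parent-colour : ∀ {u v} → p v ≡ just u → InRedBlue c (SubtreePlus p v u)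
    → (∀ z → Anc p v z → c z ≡ c v) → c u ≡ c v
  parent-colour {u} {v} e redBlue const with reduced u v e
  ... | w , vw , (_ , uw) =
    trans (colour-≡-on-edge H c noRedBlue uw (redBlue u (inj₂ refl)) (redBlue w (inj₁ vw)))
          (const w vw)

  subtree-colour : ∀ {w} → Acc (Below p) w → InRedBlue c (Subtree p w)
    → ∀ z → Anc p w z → c z ≡ c w
  subtree-colour {w} (acc below) redBlue z wz with anc-refl⊎viaChild p wz
  ... | inj₁ refl          = refl
  ... | inj₂ (v , e , vz)  =
    trans (const-v z vz) (sym (parent-colour e redBlue-plus const-v))
    where
    redBlue-plus : InRedBlue c (SubtreePlus p v w)
    redBlue-plus z (inj₁ vz)   = redBlue z (anc-trans p (anc-step e anc-refl) vz)
    redBlue-plus z (inj₂ refl) = redBlue w anc-refl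
    const-v : ∀ z → Anc p v z → c z ≡ c v
    const-v = subtree-colour (below (w , e , anc-refl)) (λ z vz → redBlue-plus z (inj₁ vz))

lemma18 : ∀ {n} (H : Hypergraph n) (c : Fin n → Colour) (p : ParentMap n)
    → NoRedBlueEdge H c → IsEliminationForest H p → IsReduced H p
    → (∀ u → InRedBlue c (Subtree p u) → Monochromatic c (Subtree p u))
      × (∀ u v → p v ≡ just u → InRedBlue c (SubtreePlus p v u) → Monochromatic c (SubtreePlus p v u))
lemma18 H c p noRedBlue elim reduced = subtree , subtreePlus
  where
  constOn : ∀ {w} → InRedBlue c (Subtree p w) → ∀ z → Anc p w z → c z ≡ c w
  constOn {w} = subtree-colour H c p noRedBlue reduced (below-wellFounded p (proj₁ elim) w)

  subtree : ∀ u → InRedBlue c (Subtree p u) → Monochromatic c (Subtree p u)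
  subtree u redBlue = monochromatic-if-constant c (Subtree p u) redBlue anc-refl (constOn redBlue)

  subtreePlus : ∀ u v → p v ≡ just u → InRedBlue c (SubtreePlus p v u)
    → Monochromatic c (SubtreePlus p v u)
  subtreePlus u v e redBlue =
    monochromatic-if-constant c (SubtreePlus p v u) redBlue (inj₁ anc-refl) const
    where
    const-v : ∀ z → Anc p v z → c z ≡ c v
    const-v = constOn (λ z vz → redBlue z (inj₁ vz))
    const : ∀ z → SubtreePlus p v u z → c z ≡ c v
    const z (inj₁ vz)   = const-v z vz
    const z (inj₂ refl) = parent-colour H c p noRedBlue reduced e redBlue const-v
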